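{- Let $H$ be a graph with vertex set $V(H)=\{v_1,\dots,v_{n(H)}\}$, let $\mathcal{X}=\{X_i:1\le i\le n(H)\}$ be a family of graphs, each with at least one vertex, and let $G=H\circ\mathcal{X}$. Let $F=\{v_i\in V(H):\mu(X_i)=\mu(v_i\circ X_i)\}$. Then: (i) $\alpha(G)=\sum_{i=1}^{n(H)}\alpha(X_i)$; (ii) $\mu(G)=\mu(H[F])+\sum_{i=1}^{n(H)}\mu(v_i\circ X_i)$; (iii) $\sum_{i=1}^{n(H)}\mu(v_i\circ X_i)=\sum_{i=1}^{n(H)}\mu(X_i)+|V(H)-F|$.
   Context: All graphs are finite, simple and undirected. $n(G)$ is the number of vertices of $G$, $\alpha(G)$ is the maximum size of an independent set of $G$, and $\mu(G)$ is the maximum size of a matching of $G$. For $S\subseteq V(H)$, $H[S]$ is the induced subgraph. The corona $H\circ\mathcal{X}$ is the graph obtained from the disjoint union of $H$ and $X_1,\dots,X_{n(H)}$ by joining each vertex $v_i$ of $H$ to all vertices of $X_i$. For a vertex $v$ and a graph $X$, $v\circ X$ denotes $K_1\circ X$, i.e., $X$ together with a new vertex $v$ adjacent to all vertices of $X$. -}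

module Defs where

open import Data.Bool using (Bool; true; false; not; _∧_; if_then_else_; T)
import Data.Bool.Properties as BoolP
open import Data.Nat using (ℕ; zero; suc; _+_; _⊔_)
import Data.Nat as ℕ
open import Data.List using (List; []; _∷_; [_]; _++_; map; concat; concatMap; foldr; length; filterᵇ)
open import Data.Nat.ListAction using (sum)
open import Data.List.Membership.Propositional using (_∈_; _∉_)
open import Data.List.Membership.Propositional.Properties
  using (∈-map⁺; ∈-map⁻; ∈-++⁺ˡ; ∈-++⁺ʳ; ∈-++⁻; ∈-concatMap⁺; ∈-concatMap⁻)
open import Data.List.Relation.Unary.Any using (Any; here; there)
import Data.List.Relation.Unary.Any as Any
open import Data.List.Relation.Binary.Disjoint.Propositional using (Disjoint)
open import Data.List.Relation.Unary.All using (All; []; _∷_)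
import Data.List.Relation.Unary.All as All
import Data.List.Relation.Unary.All.Properties as AllP
open import Data.List.Relation.Unary.AllPairs using (AllPairs; []; _∷_)
import Data.List.Relation.Unary.AllPairs as AllPairs
import Data.List.Relation.Unary.AllPairs.Properties as AllPairsP
open import Data.List.Relation.Unary.Unique.Propositional using (Unique)
import Data.List.Relation.Unary.Unique.Propositional.Properties as UniqueP
open import Data.Product using (Σ; _,_; proj₁; proj₂; _×_; ∃)
import Data.Product.Properties as ProdP
open import Data.Sum using (_⊎_; inj₁; inj₂)
import Data.Sum.Properties as SumP
open import Data.Unit using (⊤; tt)
open import Data.Empty using (⊥-elim)
open import Function using (_∘_; _on_; case_of_)
open import Relation.Binary.Definitions using (DecidableEquality)
open import Relation.Binary.PropositionalEquality using (_≡_; _≢_; refl; sym; trans; cong; subst)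
open import Relation.Nullary using (yes; no; ¬_)
open import Relation.Nullary.Decidable using (⌊_⌋)

record Graph : Set₁ where
  field
    V          : Set
    _≟V_       : DecidableEquality V
    verts      : List V
    verts-complete : ∀ v → v ∈ verts
    verts-unique   : Unique verts
    adj        : V → V → Bool
    adj-sym    : ∀ u v → adj u v ≡ adj v u
    adj-irrefl : ∀ v → adj v v ≡ false

open Graph public

nv : Graph → ℕ
nv G = length (verts G)

allᵇ : ∀ {A : Set} → (A → Bool) → List A → Bool
allᵇ p []       = true
allᵇ p (x ∷ xs) = p x ∧ allᵇ p xs

anyᵇ : ∀ {A : Set} → (A → Bool) → List A → Bool
anyᵇ p []       = false
anyᵇ p (x ∷ xs) = if p x then true else anyᵇ p xs

bool-irr : ∀ {b : Bool} (p q : b ≡ true) → p ≡ q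
bool-irr refl refl = refl

sublists : ∀ {A : Set} → List A → List (List A)
sublists []       = [ [] ]
sublists (x ∷ xs) = sublists xs ++ map (x ∷_) (sublists xs)

maxℕ : List ℕ → ℕ
maxℕ = foldr _⊔_ 0

nodupᵇ : ∀ {A : Set} → DecidableEquality A → List A → Bool
nodupᵇ _≟_ []       = true
nodupᵇ _≟_ (x ∷ xs) = not (anyᵇ (λ y → ⌊ x ≟ y ⌋) xs) ∧ nodupᵇ _≟_ xs

independentᵇ : (G : Graph) → List (V G) → Bool
independentᵇ G S = allᵇ (λ u → allᵇ (λ v → not (adj G u v)) S) S

α : Graph → ℕ
α G = maxℕ (map length (filterᵇ (independentᵇ G) (sublists (verts G))))

edgePairs : (G : Graph) → List (V G × V G)
edgePairs G = concatMap (λ u → map (u ,_) (filterᵇ (adj G u) (verts G))) (verts G)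

endpoints : ∀ {A : Set} → List (A × A) → List A
endpoints = concatMap (λ e → proj₁ e ∷ proj₂ e ∷ [])

-- a list of edges is a matching iff all its endpoints are pairwise distinct
-- (this also forbids listing an edge twice, in either orientation)
matchingᵇ : (G : Graph) → List (V G × V G) → Bool
matchingᵇ G M = nodupᵇ (_≟V_ G) (endpoints M)

μ : Graph → ℕ
μ G = maxℕ (map length (filterᵇ (matchingᵇ G) (sublists (edgePairs G))))

module _ (H : Graph) (S : V H → Bool) where

  W : Set
  W = Σ (V H) (λ v → S v ≡ true)

  cons? : (x : V H) (b : Bool) → S x ≡ b → List W → List W
  cons? x true  e r = (x , e) ∷ r
  cons? x false e r = r

  restrict : List (V H) → List W
  restrict []       = []
  restrict (x ∷ xs) = cons? x (S x) refl (restrict xs)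

  private
    decW : DecidableEquality W
    decW = ProdP.≡-dec (_≟V_ H) (λ {a} → λ p q → yes (bool-irr p q))

    true≢false : true ≢ false
    true≢false ()

    restrict-∈ : ∀ (w : W) xs → proj₁ w ∈ xs → w ∈ restrict xs
    restrict-∈ (v , p) (x ∷ xs) m = go (S x) refl m
      where
        go : ∀ b (e : S x ≡ b) → v ∈ x ∷ xs → (v , p) ∈ cons? x b e (restrict xs)
        go true  e (here refl) = here (cong (v ,_) (bool-irr p e))
        go true  e (there m)   = there (restrict-∈ (v , p) xs m)
        go false e (here refl) = ⊥-elim (true≢false (trans (sym p) e))
        go false e (there m)   = restrict-∈ (v , p) xs m

    restrict-∈⁻ : ∀ (w : W) xs → w ∈ restrict xs → proj₁ w ∈ xs
    restrict-∈⁻ w (x ∷ xs) m = go (S x) refl m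
      where
        go : ∀ b (e : S x ≡ b) → w ∈ cons? x b e (restrict xs) → proj₁ w ∈ x ∷ xs
        go true  e (here refl) = here refl
        go true  e (there m)   = there (restrict-∈⁻ w xs m)
        go false e m           = there (restrict-∈⁻ w xs m)

    restrict-uniq : ∀ xs → Unique xs → Unique (restrict xs)
    restrict-uniq [] _ = []
    restrict-uniq (x ∷ xs) (x∉ ∷ u) = go (S x) refl
      where
        go : ∀ b (e : S x ≡ b) → Unique (cons? x b e (restrict xs))
        go true  e = All.tabulate (λ {w} m eq → All.lookup x∉ (restrict-∈⁻ w xs m) (cong proj₁ eq))
                     ∷ restrict-uniq xs u
        go false e = restrict-uniq xs u

  induced : Graph
  induced = record
    { V = W
    ; _≟V_ = decW
    ; verts = restrict (verts H)
    ; verts-complete = λ w → restrict-∈ w (verts H) (verts-complete H (proj₁ w))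
    ; verts-unique = restrict-uniq (verts H) (verts-unique H)
    ; adj = λ u v → adj H (proj₁ u) (proj₁ v)
    ; adj-sym = λ u v → adj-sym H (proj₁ u) (proj₁ v)
    ; adj-irrefl = λ v → adj-irrefl H (proj₁ v)
    }

module _ (H : Graph) (X : V H → Graph) where

  CV : Set
  CV = V H ⊎ Σ (V H) (λ v → V (X v))

  private
    decΣ : DecidableEquality (Σ (V H) (λ v → V (X v)))
    decΣ = ProdP.≡-dec (_≟V_ H) (λ {a} → _≟V_ (X a))

    decCV : DecidableEquality CV
    decCV = SumP.≡-dec (_≟V_ H) decΣ

  coronaAdj : CV → CV → Bool
  coronaAdj (inj₁ u) (inj₁ v) = adj H u v
  coronaAdj (inj₁ u) (inj₂ (w , x)) = ⌊ _≟V_ H u w ⌋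
  coronaAdj (inj₂ (w , x)) (inj₁ u) = ⌊ _≟V_ H u w ⌋
  coronaAdj (inj₂ (w , x)) (inj₂ (w' , y)) with _≟V_ H w w'
  ... | yes refl = adj (X w) x y
  ... | no _     = false

  private
    sym-lemma : ∀ u v → coronaAdj u v ≡ coronaAdj v u
    sym-lemma (inj₁ u) (inj₁ v) = adj-sym H u v
    sym-lemma (inj₁ u) (inj₂ y) = refl
    sym-lemma (inj₂ y) (inj₁ u) = refl
    sym-lemma (inj₂ (w , x)) (inj₂ (w' , y)) with _≟V_ H w w' | _≟V_ H w' w
    ... | yes refl | yes refl = adj-sym (X w) x y
    ... | yes refl | no ne = ⊥-elim (ne refl)
    ... | no ne | yes refl = ⊥-elim (ne refl)
    ... | no _ | no _ = refl

    irr-lemma : ∀ v → coronaAdj v v ≡ false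
    irr-lemma (inj₁ v) = adj-irrefl H v
    irr-lemma (inj₂ (w , x)) with _≟V_ H w w
    ... | yes refl = adj-irrefl (X w) x
    ... | no _ = refl

    fib : V H → List CV
    fib w = map (λ x → inj₂ (w , x)) (verts (X w))

    cverts : List CV
    cverts = map inj₁ (verts H) ++ concatMap fib (verts H)

    complete : ∀ v → v ∈ cverts
    complete (inj₁ u) = ∈-++⁺ˡ (∈-map⁺ inj₁ (verts-complete H u))
    complete (inj₂ (w , x)) =
      ∈-++⁺ʳ (map inj₁ (verts H))
        (∈-concatMap⁺ fib {xs = verts H}
          (Any.map (λ { refl → ∈-map⁺ (λ x → inj₂ (w , x)) (verts-complete (X w) x) })
                   (verts-complete H w)))

    fib-uniq : ∀ w → Unique (fib w)
    fib-uniq w = UniqueP.map⁺ (λ { refl → refl }) (verts-unique (X w))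

    fib-inv : ∀ {v w} → v ∈ fib w → ∃ λ x → v ≡ inj₂ (w , x)
    fib-inv m with ∈-map⁻ _ m
    ... | x , _ , e = x , e

    fib-disj : ∀ {w w'} → w ≢ w' → Disjoint (fib w) (fib w')
    fib-disj ne (m1 , m2) with fib-inv m1 | fib-inv m2
    ... | x , refl | y , refl = ne refl

    inj-disj : Disjoint (map inj₁ (verts H)) (concatMap fib (verts H))
    inj-disj (m1 , m2) with ∈-map⁻ inj₁ m1 | Any.satisfied (∈-concatMap⁻ fib {xs = verts H} m2)
    ... | u , _ , refl | w , m = case fib-inv m of λ { (_ , ()) }

    cuniq : Unique cverts
    cuniq = UniqueP.++⁺ (UniqueP.map⁺ (λ { refl → refl }) (verts-unique H))
              (UniqueP.concat⁺ (AllP.map⁺ (All.tabulate (λ {w} _ → fib-uniq w)))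
                               (AllPairsP.map⁺ (AllPairs.map fib-disj (verts-unique H))))
              inj-disj

  corona : Graph
  corona = record
    { V = CV
    ; _≟V_ = decCV
    ; verts = cverts
    ; verts-complete = complete
    ; verts-unique = cuniq
    ; adj = coronaAdj
    ; adj-sym = sym-lemma
    ; adj-irrefl = irr-lemma
    }

-- K₁ and v ∘ X = K₁ ∘ X

K₁ : Graph
K₁ = record
  { V = ⊤
  ; _≟V_ = λ { tt tt → yes refl }
  ; verts = tt ∷ []
  ; verts-complete = λ { tt → here refl }
  ; verts-unique = [] ∷ []
  ; adj = λ _ _ → false
  ; adj-sym = λ _ _ → refl
  ; adj-irrefl = λ _ → refl
  }

cone : Graph → Graph
cone X = corona K₁ (λ _ → X)

inF : (H : Graph) (X : V H → Graph) → V H → Bool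
inF H X v = ⌊ μ (X v) ℕ.≟ μ (cone (X v)) ⌋

-- Write G = H ∘ 𝒳 as the blocks {v} ∪ V(X_v), v ∈ V(H), together with the edges of H.
-- (i) An independent set of G meets a block in its hub alone or in an independent set of X_v,
-- and α(X_v) ≥ 1; conversely the union of maximum independent sets of the X_v is independent.
-- (iii) At most one edge of a matching of v ∘ X covers v, so μ(X) ≤ μ(v ∘ X) ≤ μ(X) + 1,
-- and F is where the first inequality is an equality.
-- (ii) A maximum matching of H[F] together with maximum matchings of the cones v ∘ X_v is a
-- matching of G, as for v ∈ F the cone matching can be taken inside X_v. Conversely, charge each
-- edge of a matching of G that is not an edge of H[F] to a block, an edge of H to an endpoint
-- outside F. For v ∈ F the edges charged to v form a matching of v ∘ X_v; for v ∉ F at most one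
-- of them covers v and the others form a matching of X_v. Either way there are ≤ μ(v ∘ X_v).

module Submission where

open import Defs
open import Data.Bool using (Bool; true; false; not; _∧_; if_then_else_)
open import Data.Bool.Properties using (T-≡; not-injective)
open import Data.List using (List; []; _∷_; [_]; _++_; map; concatMap; length; filterᵇ)
open import Data.List.Properties using (concatMap-++; length-++; length-map; map-cong)
open import Data.List.Membership.Propositional using (_∈_; _∉_; find)
open import Data.List.Membership.Propositional.Properties
  using (∈-map⁺; ∈-map⁻; ∈-++⁺ˡ; ∈-++⁺ʳ; ∈-++⁻; ∈-concatMap⁺; ∈-concatMap⁻; ∈-filter⁺; ∈-filter⁻)
open import Data.List.Membership.Propositional.Properties.WithK using (unique∧set⇒bag)
import Data.List.Membership.DecPropositional as DecMembership
open import Data.List.Relation.Binary.BagAndSetEquality using (∼bag⇒↭; ↭⇒∼bag; >>=-cong)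
open import Data.List.Relation.Binary.Disjoint.Propositional using (Disjoint)
open import Data.List.Relation.Binary.Permutation.Propositional using (_↭_; ↭-sym; ↭⇒↭ₛ)
open import Data.List.Relation.Binary.Permutation.Propositional.Properties using (↭-length; ∈-resp-↭)
import Data.List.Relation.Binary.Permutation.Setoid.Properties as PermutationSetoid
open import Data.List.Relation.Binary.Subset.Propositional using (_⊆_)
open import Data.List.Relation.Binary.Subset.Propositional.Properties using (concatMap⁺; filter-⊆)
open import Data.List.Relation.Unary.All as All using (All; []; _∷_)
open import Data.List.Relation.Unary.All.Properties using (anti-mono)
import Data.List.Relation.Unary.All.Properties as AllP
open import Data.List.Relation.Unary.AllPairs using ([]; _∷_)
open import Data.List.Relation.Unary.Any as Any using (here; there)
open import Data.List.Relation.Unary.Unique.Propositional using (Unique)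
import Data.List.Relation.Unary.Unique.Propositional.Properties as Unique
import Data.Nat as ℕ
open import Data.Nat using (ℕ; suc; _+_; _≤_; z≤n; s≤s)
open import Data.Nat.ListAction using (sum)
open import Data.Nat.Properties
  using (module ≤-Reasoning; m≤m⊔n; m≤n⊔m; ⊔-lub; ⊔-sel; ≤-trans; ≤-antisym; ≤∧≢⇒<
        ; +-suc; +-assoc; +-mono-≤; +-monoˡ-≤; +-commutativeSemigroup)
open import Algebra.Properties.CommutativeSemigroup +-commutativeSemigroup using (interchange)
open import Data.Product using (∃; _×_; _,_; proj₁; proj₂)
import Data.Product as Product
import Data.Product.Properties as ProductP
open import Data.Sum using (_⊎_; inj₁; inj₂)
open import Data.Unit using (⊤; tt)
open import Function using (_∘_; case_of_; mk⇔; Equivalence)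
open import Function.Related.Propositional using (K-refl)
open import Relation.Binary.Definitions using (DecidableEquality)
open import Relation.Binary.PropositionalEquality
  using (_≡_; _≢_; refl; sym; trans; cong; cong₂; subst; setoid; module ≡-Reasoning)
open import Relation.Nullary using (Dec; yes; no; ¬_)
open import Relation.Nullary.Decidable using (⌊_⌋; T?)
open import Relation.Nullary.Negation using (contradiction)


module _ {P : Set} where

  ⌊⌋≡true⁻ : (d : Dec P) → ⌊ d ⌋ ≡ true → P
  ⌊⌋≡true⁻ (yes p) _ = p

  ⌊⌋≡true⁺ : (d : Dec P) → P → ⌊ d ⌋ ≡ true
  ⌊⌋≡true⁺ (yes _) _ = refl
  ⌊⌋≡true⁺ (no ¬p) p = contradiction p ¬p

  ⌊⌋≡false⁺ : (d : Dec P) → ¬ P → ⌊ d ⌋ ≡ false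
  ⌊⌋≡false⁺ (yes p) ¬p = contradiction p ¬p
  ⌊⌋≡false⁺ (no _)  _  = refl

∧≡true⁻ : ∀ {b c} → b ∧ c ≡ true → b ≡ true × c ≡ true
∧≡true⁻ {true} {true} _ = refl , refl

module _ {A : Set} (p : A → Bool) where

  ∈-filterᵇ⁻ : ∀ {x xs} → x ∈ filterᵇ p xs → x ∈ xs × p x ≡ true
  ∈-filterᵇ⁻ = Product.map₂ (Equivalence.to T-≡) ∘ ∈-filter⁻ (T? ∘ p)

  ∈-filterᵇ⁺ : ∀ {x xs} → x ∈ xs → p x ≡ true → x ∈ filterᵇ p xs
  ∈-filterᵇ⁺ x∈xs px = ∈-filter⁺ (T? ∘ p) x∈xs (Equivalence.from T-≡ px)

  allᵇ-true⁻ : ∀ xs → allᵇ p xs ≡ true → All (λ x → p x ≡ true) xs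
  allᵇ-true⁻ []       _ = []
  allᵇ-true⁻ (x ∷ xs) e with p x in px
  ... | true = px ∷ allᵇ-true⁻ xs e

  allᵇ-true⁺ : ∀ {xs} → All (λ x → p x ≡ true) xs → allᵇ p xs ≡ true
  allᵇ-true⁺ []         = refl
  allᵇ-true⁺ (px ∷ pxs) rewrite px = allᵇ-true⁺ pxs

  anyᵇ-false⁻ : ∀ xs → anyᵇ p xs ≡ false → All (λ x → p x ≡ false) xs
  anyᵇ-false⁻ []       _ = []
  anyᵇ-false⁻ (x ∷ xs) e with p x in px
  ... | false = px ∷ anyᵇ-false⁻ xs e

  anyᵇ-false⁺ : ∀ {xs} → All (λ x → p x ≡ false) xs → anyᵇ p xs ≡ false
  anyᵇ-false⁺ []         = refl
  anyᵇ-false⁺ (px ∷ pxs) rewrite px = anyᵇ-false⁺ pxs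

module _ {A : Set} (_≟_ : DecidableEquality A) where

  nodupᵇ⇒Unique : ∀ xs → nodupᵇ _≟_ xs ≡ true → Unique xs
  nodupᵇ⇒Unique []       _ = []
  nodupᵇ⇒Unique (x ∷ xs) e with anyᵇ (λ y → ⌊ x ≟ y ⌋) xs in x∉xs | nodupᵇ _≟_ xs in xs!
  nodupᵇ⇒Unique (x ∷ xs) () | true  | _
  nodupᵇ⇒Unique (x ∷ xs) () | false | false
  ... | false | true = All.map ≢x (anyᵇ-false⁻ _ xs x∉xs) ∷ nodupᵇ⇒Unique xs xs!
    where
      ≢x : ∀ {y} → ⌊ x ≟ y ⌋ ≡ false → x ≢ y
      ≢x x≟x≡false refl = case trans (sym (⌊⌋≡true⁺ (x ≟ x) refl)) x≟x≡false of λ ()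

  Unique⇒nodupᵇ : ∀ {xs} → Unique xs → nodupᵇ _≟_ xs ≡ true
  Unique⇒nodupᵇ []                   = refl
  Unique⇒nodupᵇ {x ∷ xs} (x∉xs ∷ xs!)
    rewrite anyᵇ-false⁺ (λ y → ⌊ x ≟ y ⌋) (All.map (⌊⌋≡false⁺ (x ≟ _)) x∉xs) = Unique⇒nodupᵇ xs!

length-filterᵇ-split : ∀ {A : Set} (p : A → Bool) xs →
  length xs ≡ length (filterᵇ p xs) + length (filterᵇ (not ∘ p) xs)
length-filterᵇ-split p []       = refl
length-filterᵇ-split p (x ∷ xs) with p x
... | true  = cong suc (length-filterᵇ-split p xs)
... | false = trans (cong suc (length-filterᵇ-split p xs)) (sym (+-suc _ _))

Unique∧All≡⇒length≤1 : ∀ {A : Set} {z : A} {xs} → Unique xs → All (_≡ z) xs → length xs ≤ 1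
Unique∧All≡⇒length≤1 {xs = []}         _                 _                 = z≤n
Unique∧All≡⇒length≤1 {xs = _ ∷ []}     _                 _                 = s≤s z≤n
Unique∧All≡⇒length≤1 {xs = _ ∷ _ ∷ _} ((x≢y ∷ _) ∷ _) (refl ∷ refl ∷ _) = contradiction refl x≢y

Unique-resp-↭ : ∀ {A : Set} {xs ys : List A} → xs ↭ ys → Unique xs → Unique ys
Unique-resp-↭ = PermutationSetoid.Unique-resp-↭ (setoid _) ∘ ↭⇒↭ₛ

Unique-concatMap : ∀ {A B : Set} (index : A → B) {f : B → List A} {bs : List B} →
  Unique bs → (∀ b → Unique (f b)) → (∀ b → All (λ a → index a ≡ b) (f b)) → Unique (concatMap f bs)
Unique-concatMap index {bs = []}     _            _    _       = []
Unique-concatMap index {f} {b ∷ bs} (b∉bs ∷ bs!) f-un f-index =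
  Unique.++⁺ (f-un b) (Unique-concatMap index bs! f-un f-index) disjoint
  where
    disjoint : Disjoint (f b) (concatMap f bs)
    disjoint (a∈fb , a∈rest) with find (∈-concatMap⁻ f {xs = bs} a∈rest)
    ... | b′ , b′∈bs , a∈fb′ =
      All.lookup b∉bs b′∈bs (trans (sym (All.lookup (f-index b) a∈fb)) (All.lookup (f-index b′) a∈fb′))

Unique-map⁺-on : ∀ {A B : Set} {P : A → Set} {f : A → B} → (∀ {a b} → P a → P b → f a ≡ f b → a ≡ b) →
  ∀ {xs} → All P xs → Unique xs → Unique (map f xs)
Unique-map⁺-on inj []         []           = []
Unique-map⁺-on inj (px ∷ pxs) (x∉xs ∷ xs!) =
  AllP.map⁺ (All.tabulate λ y∈ fx≡fy → All.lookup x∉xs y∈ (inj px (All.lookup pxs y∈) fx≡fy))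
  ∷ Unique-map⁺-on inj pxs xs!

module _ {A : Set} where

  sum-map-mono-≤ : ∀ {f g : A → ℕ} → (∀ x → f x ≤ g x) → ∀ xs → sum (map f xs) ≤ sum (map g xs)
  sum-map-mono-≤ f≤g []       = z≤n
  sum-map-mono-≤ f≤g (x ∷ xs) = +-mono-≤ (f≤g x) (sum-map-mono-≤ f≤g xs)

  sum-map-+ : ∀ (f g : A → ℕ) xs → sum (map (λ x → f x + g x) xs) ≡ sum (map f xs) + sum (map g xs)
  sum-map-+ f g []       = refl
  sum-map-+ f g (x ∷ xs) = trans (cong (f x + g x +_) (sum-map-+ f g xs)) (interchange (f x) (g x) _ _)

  sum-map-zero : ∀ {f : A → ℕ} {xs} → All (λ x → f x ≡ 0) xs → sum (map f xs) ≡ 0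
  sum-map-zero []           = refl
  sum-map-zero (fx≡0 ∷ f≡0) = cong₂ _+_ fx≡0 (sum-map-zero f≡0)

  length-concatMap : ∀ {B : Set} (f : A → List B) xs → length (concatMap f xs) ≡ sum (map (length ∘ f) xs)
  length-concatMap f []       = refl
  length-concatMap f (x ∷ xs) = trans (length-++ (f x)) (cong (length (f x) +_) (length-concatMap f xs))

  sum-map≡sum-map+count : ∀ (f g : A → ℕ) (q : A → Bool) →
    (∀ x → q x ≡ true → f x ≡ suc (g x)) → (∀ x → q x ≡ false → f x ≡ g x) →
    ∀ xs → sum (map f xs) ≡ sum (map g xs) + length (filterᵇ q xs)
  sum-map≡sum-map+count f g q f≡suc f≡ []       = refl
  sum-map≡sum-map+count f g q f≡suc f≡ (x ∷ xs) with q x in qx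
  ... | true  = begin
    f x + sum (map f xs)                                       ≡⟨ cong₂ _+_ (f≡suc x qx) rest ⟩
    suc (g x) + (sum (map g xs) + length (filterᵇ q xs))       ≡⟨ cong suc (+-assoc (g x) _ _) ⟨
    suc (g x + sum (map g xs) + length (filterᵇ q xs))         ≡⟨ +-suc _ _ ⟨
    g x + sum (map g xs) + suc (length (filterᵇ q xs))         ∎
    where
      open ≡-Reasoning
      rest = sum-map≡sum-map+count f g q f≡suc f≡ xs
  ... | false = trans (cong₂ _+_ (f≡ x qx) (sum-map≡sum-map+count f g q f≡suc f≡ xs)) (sym (+-assoc (g x) _ _))

module Fibres {A B : Set} (key : A → B) (_≟_ : DecidableEquality B) where

  fibre : B → List A → List A
  fibre b = filterᵇ (λ a → ⌊ key a ≟ b ⌋)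

  All-fibre : ∀ b S → All (λ a → key a ≡ b) (fibre b S)
  All-fibre b S = All.tabulate (λ a∈ → ⌊⌋≡true⁻ (key _ ≟ b) (proj₂ (∈-filterᵇ⁻ _ {xs = S} a∈)))

  private
    length-fibre-∷ : ∀ a S b → length (fibre b (a ∷ S)) ≡ length (fibre b [ a ]) + length (fibre b S)
    length-fibre-∷ a S b with key a ≟ b
    ... | yes _ = refl
    ... | no  _ = refl

    sum-length-fibre-[_] : ∀ a {bs} → Unique bs → key a ∈ bs → sum (map (λ b → length (fibre b [ a ])) bs) ≡ 1
    sum-length-fibre-[ a ] {b ∷ bs} (b∉bs ∷ bs!) ka∈ with key a ≟ b
    ... | yes refl = cong suc (sum-map-zero (All.map miss b∉bs))
      where
        miss : ∀ {b′} → key a ≢ b′ → length (fibre b′ [ a ]) ≡ 0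
        miss {b′} ka≢b′ with key a ≟ b′
        ... | yes ka≡b′ = contradiction ka≡b′ ka≢b′
        ... | no  _     = refl
    ... | no ka≢b with ka∈
    ...   | here ka≡b   = contradiction ka≡b ka≢b
    ...   | there ka∈bs = sum-length-fibre-[ a ] bs! ka∈bs

  length≡sum-length-fibre : ∀ {bs} → Unique bs → (∀ a → key a ∈ bs) →
    ∀ S → length S ≡ sum (map (λ b → length (fibre b S)) bs)
  length≡sum-length-fibre {bs} bs! complete []       = sym (sum-map-zero {xs = bs} (All.tabulate (λ _ → refl)))
  length≡sum-length-fibre {bs} bs! complete (a ∷ S) = begin
    suc (length S)
      ≡⟨ cong suc (length≡sum-length-fibre bs! complete S) ⟩
    1 + sum (map (λ b → length (fibre b S)) bs)
      ≡⟨ cong (_+ _) (sum-length-fibre-[ a ] bs! (complete a)) ⟨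
    sum (map (λ b → length (fibre b [ a ])) bs) + sum (map (λ b → length (fibre b S)) bs)
      ≡⟨ sum-map-+ _ _ bs ⟨
    sum (map (λ b → length (fibre b [ a ]) + length (fibre b S)) bs)
      ≡⟨ cong sum (map-cong (length-fibre-∷ a S) bs) ⟨
    sum (map (λ b → length (fibre b (a ∷ S))) bs)
      ∎
    where open ≡-Reasoning

module _ {A : Set} where

  []∈sublists : (xs : List A) → [] ∈ sublists xs
  []∈sublists []       = here refl
  []∈sublists (x ∷ xs) = ∈-++⁺ˡ ([]∈sublists xs)

  filterᵇ∈sublists : (p : A → Bool) (xs : List A) → filterᵇ p xs ∈ sublists xs
  filterᵇ∈sublists p []       = here refl
  filterᵇ∈sublists p (x ∷ xs) with p x
  ... | true  = ∈-++⁺ʳ (sublists xs) (∈-map⁺ (x ∷_) (filterᵇ∈sublists p xs))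
  ... | false = ∈-++⁺ˡ (filterᵇ∈sublists p xs)

  ∈-sublists⇒⊆ : ∀ {S} (xs : List A) → S ∈ sublists xs → S ⊆ xs
  ∈-sublists⇒⊆ []       (here refl) ()
  ∈-sublists⇒⊆ (x ∷ xs) S∈ y∈S with ∈-++⁻ (sublists xs) S∈
  ... | inj₁ S∈′ = there (∈-sublists⇒⊆ xs S∈′ y∈S)
  ... | inj₂ xS∈ with ∈-map⁻ (x ∷_) xS∈
  ...   | S′ , S′∈ , refl with y∈S
  ...     | here y≡x   = here y≡x
  ...     | there y∈S′ = there (∈-sublists⇒⊆ xs S′∈ y∈S′)

  ∈-sublists⇒Unique : ∀ {S} (xs : List A) → Unique xs → S ∈ sublists xs → Unique S
  ∈-sublists⇒Unique []       _            (here refl) = []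
  ∈-sublists⇒Unique (x ∷ xs) (x∉xs ∷ xs!) S∈ with ∈-++⁻ (sublists xs) S∈
  ... | inj₁ S∈′ = ∈-sublists⇒Unique xs xs! S∈′
  ... | inj₂ xS∈ with ∈-map⁻ (x ∷_) xS∈
  ...   | S′ , S′∈ , refl =
    All.tabulate (All.lookup x∉xs ∘ ∈-sublists⇒⊆ xs S′∈) ∷ ∈-sublists⇒Unique xs xs! S′∈

  module _ (_≟_ : DecidableEquality A) where
    open DecMembership _≟_ using (_∈?_)

    ∃-sublist-↭ : ∀ {S xs} → Unique S → Unique xs → S ⊆ xs → ∃ λ S′ → S′ ∈ sublists xs × S′ ↭ S
    ∃-sublist-↭ {S} {xs} S! xs! S⊆xs =
      S′ , filterᵇ∈sublists inS xs , ∼bag⇒↭ (unique∧set⇒bag (Unique.filter⁺ _ xs!) S! (mk⇔ to from))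
      where
        inS : A → Bool
        inS x = ⌊ x ∈? S ⌋
        S′ = filterᵇ inS xs
        to : ∀ {x} → x ∈ S′ → x ∈ S
        to x∈S′ = ⌊⌋≡true⁻ (_ ∈? S) (proj₂ (∈-filterᵇ⁻ inS {xs = xs} x∈S′))
        from : ∀ {x} → x ∈ S → x ∈ S′
        from x∈S = ∈-filterᵇ⁺ inS (S⊆xs x∈S) (⌊⌋≡true⁺ (_ ∈? S) x∈S)

≤-maxℕ : ∀ {x xs} → x ∈ xs → x ≤ maxℕ xs
≤-maxℕ {xs = y ∷ xs} (here refl) = m≤m⊔n y (maxℕ xs)
≤-maxℕ {xs = y ∷ xs} (there x∈) = ≤-trans (≤-maxℕ x∈) (m≤n⊔m y (maxℕ xs))

maxℕ-≤ : ∀ {k xs} → (∀ {x} → x ∈ xs → x ≤ k) → maxℕ xs ≤ k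
maxℕ-≤ {xs = []}     _     = z≤n
maxℕ-≤ {xs = y ∷ xs} bound = ⊔-lub (bound (here refl)) (maxℕ-≤ (bound ∘ there))

maxℕ∈0∷ : ∀ xs → maxℕ xs ∈ 0 ∷ xs
maxℕ∈0∷ []       = here refl
maxℕ∈0∷ (y ∷ xs) with ⊔-sel y (maxℕ xs)
... | inj₁ ⊔≡y = there (here ⊔≡y)
... | inj₂ ⊔≡m with maxℕ∈0∷ xs
...   | here m≡0   = here (trans ⊔≡m m≡0)
...   | there m∈xs = there (there (subst (_∈ xs) (sym ⊔≡m) m∈xs))

module MaxSublist {A : Set} (p : List A → Bool) (xs : List A) where

  maxLength : ℕ
  maxLength = maxℕ (map length (filterᵇ p (sublists xs)))

  ≤-maxLength : ∀ {S} → S ∈ sublists xs → p S ≡ true → length S ≤ maxLength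
  ≤-maxLength S∈ pS = ≤-maxℕ (∈-map⁺ length (∈-filterᵇ⁺ p S∈ pS))

  maxLength-≤ : ∀ {k} → (∀ {S} → S ∈ sublists xs → p S ≡ true → length S ≤ k) → maxLength ≤ k
  maxLength-≤ {k} bound = maxℕ-≤ lengthBound
    where
      lengthBound : ∀ {n} → n ∈ map length (filterᵇ p (sublists xs)) → n ≤ k
      lengthBound n∈ with ∈-map⁻ length n∈
      ... | S , S∈ , refl = Product.uncurry bound (∈-filterᵇ⁻ p S∈)

  maxLength-attained : p [] ≡ true → ∃ λ S → S ∈ sublists xs × p S ≡ true × length S ≡ maxLength
  maxLength-attained p[] with maxℕ∈0∷ (map length (filterᵇ p (sublists xs)))
  ... | here max≡0 = [] , []∈sublists xs , p[] , sym max≡0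
  ... | there max∈ with ∈-map⁻ length max∈
  ...   | S , S∈ , max≡ = S , Product.map₂ (_, sym max≡) (∈-filterᵇ⁻ p {xs = sublists xs} S∈)

-- Independent sets and matchings

module _ {A : Set} where

  ends : A × A → List A
  ends e = proj₁ e ∷ proj₂ e ∷ []

  ∈-endpoints⁺ : ∀ {x e M} → e ∈ M → x ∈ ends e → x ∈ endpoints M
  ∈-endpoints⁺ {M = M} e∈M x∈e = ∈-concatMap⁺ ends {xs = M} (Any.map (λ { refl → x∈e }) e∈M)

  ∈-endpoints⁻ : ∀ {x} M → x ∈ endpoints M → ∃ λ e → e ∈ M × x ∈ ends e
  ∈-endpoints⁻ M x∈ = find (∈-concatMap⁻ ends {xs = M} x∈)

  endpoints-++ : ∀ (M N : List (A × A)) → endpoints (M ++ N) ≡ endpoints M ++ endpoints N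
  endpoints-++ = concatMap-++ ends

  endpoints-↭ : ∀ {M N : List (A × A)} → M ↭ N → endpoints M ↭ endpoints N
  endpoints-↭ M↭N = ∼bag⇒↭ (>>=-cong (↭⇒∼bag M↭N) (λ _ → K-refl))

  Unique-endpoints⇒Unique : ∀ {M : List (A × A)} → Unique (endpoints M) → Unique M
  Unique-endpoints⇒Unique {[]}    _                    = []
  Unique-endpoints⇒Unique {e ∷ M} ((_ ∷ e₁∉) ∷ _ ∷ M!) =
    All.tabulate (λ e′∈M e≡e′ → All.lookup e₁∉ (∈-endpoints⁺ e′∈M (here (cong proj₁ e≡e′))) refl)
    ∷ Unique-endpoints⇒Unique M!

  endpoints-concatMap : ∀ {B : Set} (f : B → List (A × A)) bs →
    endpoints (concatMap f bs) ≡ concatMap (endpoints ∘ f) bs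
  endpoints-concatMap f []       = refl
  endpoints-concatMap f (b ∷ bs) =
    trans (endpoints-++ (f b) (concatMap f bs)) (cong (endpoints (f b) ++_) (endpoints-concatMap f bs))

  endpoints-filterᵇ-⊆ : ∀ (p : A × A → Bool) M → endpoints (filterᵇ p M) ⊆ endpoints M
  endpoints-filterᵇ-⊆ p M = concatMap⁺ ends (filter-⊆ (T? ∘ p) M)

  Unique-endpoints-filterᵇ : ∀ (p : A × A → Bool) {M} → Unique (endpoints M) → Unique (endpoints (filterᵇ p M))
  Unique-endpoints-filterᵇ p {[]}    _                           = []
  Unique-endpoints-filterᵇ p {e ∷ M} ((e₁≢e₂ ∷ e₁∉) ∷ e₂∉ ∷ M!) with p e
  ... | true  = (e₁≢e₂ ∷ anti-mono (endpoints-filterᵇ-⊆ p M) e₁∉)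
              ∷ anti-mono (endpoints-filterᵇ-⊆ p M) e₂∉ ∷ Unique-endpoints-filterᵇ p {M} M!
  ... | false = Unique-endpoints-filterᵇ p {M} M!

  covering-length≤1 : ∀ {z} D → Unique (endpoints D) → All (λ e → z ∈ ends e) D → length D ≤ 1
  covering-length≤1 []            _                      _                  = z≤n
  covering-length≤1 (_ ∷ [])      _                      _                  = s≤s z≤n
  covering-length≤1 (d ∷ d′ ∷ D) ((_ ∷ d₁∉) ∷ d₂∉ ∷ _) (z∈d ∷ z∈d′ ∷ _) =
    contradiction (∈-endpoints⁺ {M = d′ ∷ D} (here refl) z∈d′) (∉rest z∈d)
    where
      ∉rest : ∀ {z} → z ∈ ends d → z ∉ endpoints (d′ ∷ D)
      ∉rest (here z≡d₁)         z∈ = All.lookup d₁∉ z∈ (sym z≡d₁)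
      ∉rest (there (here z≡d₂)) z∈ = All.lookup d₂∉ z∈ (sym z≡d₂)

  module _ (_≟_ : DecidableEquality A) where
    open DecMembership _≟_ using (_∈?_)

    avoiding : A → List (A × A) → List (A × A)
    avoiding z = filterᵇ (λ e → not ⌊ z ∈? ends e ⌋)

    ∈-avoiding⁻ : ∀ {e} z M → e ∈ avoiding z M → e ∈ M × z ∉ ends e
    ∈-avoiding⁻ {e} z M e∈ with ∈-filterᵇ⁻ _ {xs = M} e∈
    ... | e∈M , z∉e = e∈M , λ z∈e → case trans (sym z∉e) (cong not (⌊⌋≡true⁺ (z ∈? ends e) z∈e)) of λ ()

    ∉-endpoints-avoiding : ∀ z M → z ∉ endpoints (avoiding z M)
    ∉-endpoints-avoiding z M z∈ with ∈-endpoints⁻ (avoiding z M) z∈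
    ... | e , e∈ , z∈e = proj₂ (∈-avoiding⁻ z M e∈) z∈e

    length≤suc-avoiding : ∀ z M → Unique (endpoints M) → length M ≤ suc (length (avoiding z M))
    length≤suc-avoiding z M M! = subst (_≤ suc (length (avoiding z M))) (sym (length-filterᵇ-split covers M))
      (+-monoˡ-≤ _ (covering-length≤1 (filterᵇ covers M) (Unique-endpoints-filterᵇ covers {M} M!)
                    (All.tabulate (λ e∈ → ⌊⌋≡true⁻ (z ∈? _) (proj₂ (∈-filterᵇ⁻ covers {xs = M} e∈))))))
      where
        covers : A × A → Bool
        covers e = ⌊ z ∈? ends e ⌋

mapEdges : ∀ {A B : Set} → (A → B) → List (A × A) → List (B × B)
mapEdges f = map (Product.map f f)

endpoints-mapEdges : ∀ {A B : Set} (f : A → B) M → endpoints (mapEdges f M) ≡ map f (endpoints M)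
endpoints-mapEdges f []      = refl
endpoints-mapEdges f (e ∷ M) = cong (λ rest → f (proj₁ e) ∷ f (proj₂ e) ∷ rest) (endpoints-mapEdges f M)

Adjacent : (G : Graph) → V G × V G → Set
Adjacent G e = adj G (proj₁ e) (proj₂ e) ≡ true

record IsMatching (G : Graph) (M : List (V G × V G)) : Set where
  field
    adjacent         : All (Adjacent G) M
    endpoints-unique : Unique (endpoints M)

record IsIndependent (G : Graph) (S : List (V G)) : Set where
  field
    unique      : Unique S
    nonadjacent : ∀ {u v} → u ∈ S → v ∈ S → adj G u v ≡ false

module _ (G : Graph) where

  private
    neighbourPairs : V G → List (V G × V G)
    neighbourPairs u = map (u ,_) (filterᵇ (adj G u) (verts G))

  ∈-edgePairs⁺ : ∀ {e} → Adjacent G e → e ∈ edgePairs G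
  ∈-edgePairs⁺ {u , v} uv = ∈-concatMap⁺ neighbourPairs {xs = verts G}
    (Any.map (λ { refl → ∈-map⁺ (u ,_) (∈-filterᵇ⁺ (adj G u) (verts-complete G v) uv) }) (verts-complete G u))

  ∈-edgePairs⁻ : ∀ {e} → e ∈ edgePairs G → Adjacent G e
  ∈-edgePairs⁻ e∈ with find (∈-concatMap⁻ neighbourPairs {xs = verts G} e∈)
  ... | u , _ , e∈nbr with ∈-map⁻ (u ,_) e∈nbr
  ...   | v , v∈ , refl = proj₂ (∈-filterᵇ⁻ (adj G u) {xs = verts G} v∈)

  edgePairs-unique : Unique (edgePairs G)
  edgePairs-unique = Unique-concatMap proj₁ (verts-unique G)
    (λ u → Unique.map⁺ (cong proj₂) (Unique.filter⁺ _ (verts-unique G)))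
    (λ u → All.tabulate (λ e∈ → case ∈-map⁻ (u ,_) e∈ of λ { (_ , _ , refl) → refl }))

  independentᵇ⇒ : ∀ S → independentᵇ G S ≡ true → ∀ {u v} → u ∈ S → v ∈ S → adj G u v ≡ false
  independentᵇ⇒ S ind u∈ v∈ =
    not-injective (All.lookup (allᵇ-true⁻ _ S (All.lookup (allᵇ-true⁻ _ S ind) u∈)) v∈)

  independentᵇ⇐ : ∀ {S} → (∀ {u v} → u ∈ S → v ∈ S → adj G u v ≡ false) → independentᵇ G S ≡ true
  independentᵇ⇐ nonadj = allᵇ-true⁺ _ (All.tabulate λ u∈ → allᵇ-true⁺ _ (All.tabulate λ v∈ → cong not (nonadj u∈ v∈)))

  -- α G and μ G unfold to the maxLength of these two modules.
  private
    module Independent = MaxSublist (independentᵇ G) (verts G)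
    module Matching    = MaxSublist (matchingᵇ G) (edgePairs G)

    sublist⇒IsIndependent : ∀ {S} → S ∈ sublists (verts G) → independentᵇ G S ≡ true → IsIndependent G S
    sublist⇒IsIndependent {S} S∈ ind = record
      { unique      = ∈-sublists⇒Unique (verts G) (verts-unique G) S∈
      ; nonadjacent = independentᵇ⇒ S ind
      }

    sublist⇒IsMatching : ∀ {M} → M ∈ sublists (edgePairs G) → matchingᵇ G M ≡ true → IsMatching G M
    sublist⇒IsMatching {M} M∈ m = record
      { adjacent         = All.tabulate (∈-edgePairs⁻ ∘ ∈-sublists⇒⊆ (edgePairs G) M∈)
      ; endpoints-unique = nodupᵇ⇒Unique (_≟V_ G) (endpoints M) m
      }

  independent⇒≤α : ∀ {S} → IsIndependent G S → length S ≤ α G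
  independent⇒≤α {S} S-ind
    with ∃-sublist-↭ (_≟V_ G) (IsIndependent.unique S-ind) (verts-unique G) (λ _ → verts-complete G _)
  ... | S′ , S′∈ , S′↭S = subst (_≤ α G) (↭-length S′↭S) (Independent.≤-maxLength S′∈ (independentᵇ⇐ nonadj′))
    where
      open IsIndependent S-ind
      nonadj′ : ∀ {u v} → u ∈ S′ → v ∈ S′ → adj G u v ≡ false
      nonadj′ u∈ v∈ = nonadjacent (∈-resp-↭ S′↭S u∈) (∈-resp-↭ S′↭S v∈)

  α-≤ : ∀ {k} → (∀ {S} → IsIndependent G S → length S ≤ k) → α G ≤ k
  α-≤ bound = Independent.maxLength-≤ λ S∈ ind → bound (sublist⇒IsIndependent S∈ ind)

  maximumIndependentSet : ∃ λ S → IsIndependent G S × length S ≡ α G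
  maximumIndependentSet with Independent.maxLength-attained refl
  ... | S , S∈ , ind , |S|≡α = S , sublist⇒IsIndependent S∈ ind , |S|≡α

  1≤α : V G → 1 ≤ α G
  1≤α x = independent⇒≤α {x ∷ []} (record
    { unique      = [] ∷ []
    ; nonadjacent = λ { (here refl) (here refl) → adj-irrefl G x }
    })

  matching⇒≤μ : ∀ {M} → IsMatching G M → length M ≤ μ G
  matching⇒≤μ {M} M-match
    with ∃-sublist-↭ (ProductP.≡-dec (_≟V_ G) (_≟V_ G)) (Unique-endpoints⇒Unique (IsMatching.endpoints-unique M-match))
                     edgePairs-unique (∈-edgePairs⁺ ∘ All.lookup (IsMatching.adjacent M-match))
  ... | M′ , M′∈ , M′↭M = subst (_≤ μ G) (↭-length M′↭M) (Matching.≤-maxLength M′∈ matching′)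
    where
      matching′ : matchingᵇ G M′ ≡ true
      matching′ = Unique⇒nodupᵇ (_≟V_ G)
        (Unique-resp-↭ (endpoints-↭ (↭-sym M′↭M)) (IsMatching.endpoints-unique M-match))

  μ-≤ : ∀ {k} → (∀ {M} → IsMatching G M → length M ≤ k) → μ G ≤ k
  μ-≤ bound = Matching.maxLength-≤ λ M∈ m → bound (sublist⇒IsMatching M∈ m)

  maximumMatching : ∃ λ M → IsMatching G M × length M ≡ μ G
  maximumMatching with Matching.maxLength-attained refl
  ... | M , M∈ , m , |M|≡μ = M , sublist⇒IsMatching M∈ m , |M|≡μ

record EmbeddingOn (G G′ : Graph) (P : V G → Set) (f : V G → V G′) : Set where
  field
    adj-≡     : ∀ {a b} → P a → P b → adj G′ (f a) (f b) ≡ adj G a b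
    injective : ∀ {a b} → P a → P b → f a ≡ f b → a ≡ b

module _ {G G′ : Graph} {P : V G → Set} {f : V G → V G′} (emb : EmbeddingOn G G′ P f) where
  open EmbeddingOn emb

  mapEdges-IsMatching : ∀ {M} → IsMatching G M → All P (endpoints M) → IsMatching G′ (mapEdges f M)
  mapEdges-IsMatching {M} M-match P-ends = record
    { adjacent         = AllP.map⁺ (All.tabulate λ e∈ →
                           trans (adj-≡ (P-end e∈ (here refl)) (P-end e∈ (there (here refl)))) (All.lookup adjacent e∈))
    ; endpoints-unique = subst Unique (sym (endpoints-mapEdges f M)) (Unique-map⁺-on injective P-ends endpoints-unique)
    }
    where
      open IsMatching M-match
      P-end : ∀ {e x} → e ∈ M → x ∈ ends e → P x
      P-end e∈ x∈ = All.lookup P-ends (∈-endpoints⁺ e∈ x∈)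

  matching⇒≤μ-via : ∀ {M} → IsMatching G M → All P (endpoints M) → length M ≤ μ G′
  matching⇒≤μ-via {M} M-match P-ends =
    subst (_≤ μ G′) (length-map _ M) (matching⇒≤μ G′ (mapEdges-IsMatching M-match P-ends))

  independent⇒≤α-via : ∀ {S} → IsIndependent G S → All P S → length S ≤ α G′
  independent⇒≤α-via {S} S-ind P-S = subst (_≤ α G′) (length-map f S) (independent⇒≤α G′ (record
    { unique      = Unique-map⁺-on injective P-S unique
    ; nonadjacent = nonadjacent′
    }))
    where
      open IsIndependent S-ind
      nonadjacent′ : ∀ {u v} → u ∈ map f S → v ∈ map f S → adj G′ u v ≡ false
      nonadjacent′ u∈ v∈ with ∈-map⁻ f u∈ | ∈-map⁻ f v∈
      ... | a , a∈ , refl | b , b∈ , refl = trans (adj-≡ (All.lookup P-S a∈) (All.lookup P-S b∈)) (nonadjacent a∈ b∈)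

EmbeddingOn-∘ : ∀ {G₁ G₂ G₃ : Graph} {P Q R} {f : V G₁ → V G₂} {g : V G₂ → V G₃} →
  (∀ {a} → R a → P a × Q (f a)) → EmbeddingOn G₁ G₂ P f → EmbeddingOn G₂ G₃ Q g → EmbeddingOn G₁ G₃ R (g ∘ f)
EmbeddingOn-∘ R⇒ f-emb g-emb = record
  { adj-≡     = λ Ra Rb → trans (Gm.adj-≡ (proj₂ (R⇒ Ra)) (proj₂ (R⇒ Rb))) (F.adj-≡ (proj₁ (R⇒ Ra)) (proj₁ (R⇒ Rb)))
  ; injective = λ Ra Rb → F.injective (proj₁ (R⇒ Ra)) (proj₁ (R⇒ Rb)) ∘ Gm.injective (proj₂ (R⇒ Ra)) (proj₂ (R⇒ Rb))
  }
  where
    module F = EmbeddingOn f-emb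
    module Gm = EmbeddingOn g-emb

module _ {G : Graph} where

  filterᵇ-IsIndependent : ∀ p {S} → IsIndependent G S → IsIndependent G (filterᵇ p S)
  filterᵇ-IsIndependent p {S} S-ind = record
    { unique      = Unique.filter⁺ _ unique
    ; nonadjacent = λ u∈ v∈ → nonadjacent (filter-⊆ (T? ∘ p) S u∈) (filter-⊆ (T? ∘ p) S v∈)
    }
    where open IsIndependent S-ind

  filterᵇ-IsMatching : ∀ p {M} → IsMatching G M → IsMatching G (filterᵇ p M)
  filterᵇ-IsMatching p {M} M-match = record
    { adjacent         = anti-mono (filter-⊆ (T? ∘ p) M) adjacent
    ; endpoints-unique = Unique-endpoints-filterᵇ p {M} endpoints-unique
    }
    where open IsMatching M-match

  ++-IsMatching : ∀ {M N} → IsMatching G M → IsMatching G N → Disjoint (endpoints M) (endpoints N) →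
    IsMatching G (M ++ N)
  ++-IsMatching {M} {N} M-match N-match disjoint = record
    { adjacent         = AllP.++⁺ (IsMatching.adjacent M-match) (IsMatching.adjacent N-match)
    ; endpoints-unique = subst Unique (sym (endpoints-++ M N))
        (Unique.++⁺ (IsMatching.endpoints-unique M-match) (IsMatching.endpoints-unique N-match) disjoint)
    }

  concatMap-IsMatching : ∀ {B : Set} (index : V G → B) {f : B → List (V G × V G)} {bs} → Unique bs →
    (∀ b → IsMatching G (f b)) → (∀ b → All (λ a → index a ≡ b) (endpoints (f b))) →
    IsMatching G (concatMap f bs)
  concatMap-IsMatching index {f} {bs} bs! f-match f-index = record
    { adjacent         = AllP.concat⁺ (AllP.map⁺ {xs = bs} (All.tabulate λ {b} _ → IsMatching.adjacent (f-match b)))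
    ; endpoints-unique = subst Unique (sym (endpoints-concatMap f bs))
        (Unique-concatMap index bs! (IsMatching.endpoints-unique ∘ f-match) f-index)
    }

module _ (H : Graph) (S : V H → Bool) where

  private
    liftEdges : ∀ M → All (λ x → S x ≡ true) (endpoints M) → List (V (induced H S) × V (induced H S))
    liftEdges []            _               = []
    liftEdges ((a , b) ∷ M) (Sa ∷ Sb ∷ S-M) = ((a , Sa) , (b , Sb)) ∷ liftEdges M S-M

    mapEdges-proj₁-liftEdges : ∀ M S-M → mapEdges proj₁ (liftEdges M S-M) ≡ M
    mapEdges-proj₁-liftEdges []            _               = refl
    mapEdges-proj₁-liftEdges ((a , b) ∷ M) (Sa ∷ Sb ∷ S-M) = cong ((a , b) ∷_) (mapEdges-proj₁-liftEdges M S-M)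

  matching⇒≤μ-induced : ∀ {M} → IsMatching H M → All (λ x → S x ≡ true) (endpoints M) → length M ≤ μ (induced H S)
  matching⇒≤μ-induced {M} M-match S-M = subst (_≤ μ (induced H S)) |lift|≡|M| (matching⇒≤μ (induced H S) (record
    { adjacent         = AllP.map⁻ (subst (All (Adjacent H)) (sym lift≡M) adjacent)
    ; endpoints-unique = Unique.map⁻ (subst Unique (sym ends≡) endpoints-unique)
    }))
    where
      open IsMatching M-match
      lifted = liftEdges M S-M
      lift≡M = mapEdges-proj₁-liftEdges M S-M
      ends≡ : map proj₁ (endpoints lifted) ≡ endpoints M
      ends≡ = trans (sym (endpoints-mapEdges proj₁ lifted)) (cong endpoints lift≡M)
      |lift|≡|M| : length lifted ≡ length M
      |lift|≡|M| = trans (sym (length-map _ lifted)) (cong length lift≡M)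

-- Cones

module Cone (Y : Graph) where

  apex : V (cone Y)
  apex = inj₁ tt

  leaf : V Y → V (cone Y)
  leaf y = inj₂ (tt , y)

  leaf-embedding : EmbeddingOn Y (cone Y) (λ _ → ⊤) leaf
  leaf-embedding = record
    { adj-≡     = λ _ _ → refl
    ; injective = λ { _ _ refl → refl }
    }

  -- y₀ is a junk value for the apex, which unleaf-embedding excludes.
  unleaf : V Y → V (cone Y) → V Y
  unleaf y₀ (inj₁ _)       = y₀
  unleaf y₀ (inj₂ (_ , y)) = y

  unleaf-embedding : (y₀ : V Y) → EmbeddingOn (cone Y) Y (_≢ apex) (unleaf y₀)
  unleaf-embedding y₀ = record
    { adj-≡     = λ { {inj₂ _} {inj₂ _} _ _ → refl
                    ; {inj₁ tt} a≢apex _ → contradiction refl a≢apex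
                    ; {_} {inj₁ tt} _ b≢apex → contradiction refl b≢apex }
    ; injective = λ { {inj₂ _} {inj₂ _} _ _ refl → refl
                    ; {inj₁ tt} a≢apex _ _ → contradiction refl a≢apex
                    ; {_} {inj₁ tt} _ b≢apex _ → contradiction refl b≢apex }
    }

  μ≤μ-cone : μ Y ≤ μ (cone Y)
  μ≤μ-cone with maximumMatching Y
  ... | M , M-match , |M|≡μ =
    subst (_≤ μ (cone Y)) |M|≡μ (matching⇒≤μ-via leaf-embedding M-match (All.tabulate (λ _ → tt)))

  apex-free⇒≤μ : V Y → ∀ {M} → IsMatching (cone Y) M → apex ∉ endpoints M → length M ≤ μ Y
  apex-free⇒≤μ y₀ M-match apex∉ =
    matching⇒≤μ-via (unleaf-embedding y₀) M-match (All.tabulate λ { a∈ refl → apex∉ a∈ })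

  μ-cone≤suc : V Y → μ (cone Y) ≤ suc (μ Y)
  μ-cone≤suc y₀ = μ-≤ (cone Y) λ {M} M-match →
    ≤-trans (length≤suc-avoiding (_≟V_ (cone Y)) apex M (IsMatching.endpoints-unique M-match))
            (s≤s (apex-free⇒≤μ y₀ (filterᵇ-IsMatching _ M-match) (∉-endpoints-avoiding (_≟V_ (cone Y)) apex M)))

  μ-cone≡suc : V Y → μ Y ≢ μ (cone Y) → μ (cone Y) ≡ suc (μ Y)
  μ-cone≡suc y₀ μ≢ = ≤-antisym (μ-cone≤suc y₀) (≤∧≢⇒< μ≤μ-cone μ≢)

  apex-free-maximumMatching : μ Y ≡ μ (cone Y) →
    ∃ λ M → IsMatching (cone Y) M × length M ≡ μ (cone Y) × apex ∉ endpoints M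
  apex-free-maximumMatching μ≡ with maximumMatching Y
  ... | M , M-match , |M|≡μ =
    mapEdges leaf M ,
    mapEdges-IsMatching leaf-embedding M-match (All.tabulate (λ _ → tt)) ,
    trans (length-map _ M) (trans |M|≡μ μ≡) ,
    apex∉
    where
      apex∉ : apex ∉ endpoints (mapEdges leaf M)
      apex∉ apex∈ with ∈-map⁻ leaf (subst (apex ∈_) (endpoints-mapEdges leaf M) apex∈)
      ... | _ , _ , ()

-- Coronas

module Corona (H : Graph) (X : V H → Graph) where

  G : Graph
  G = corona H X

  private
    _≟_ = _≟V_ H

  block : V G → V H
  block (inj₁ u)       = u
  block (inj₂ (v , _)) = v

  data InBlock (v : V H) : V G → Set where
    hub  : InBlock v (inj₁ v)
    leaf : ∀ x → InBlock v (inj₂ (v , x))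

  inBlock : ∀ {v} a → block a ≡ v → InBlock v a
  inBlock (inj₁ _)       refl = hub
  inBlock (inj₂ (_ , x)) refl = leaf x

  adj-hub-leaf : ∀ v x → adj G (inj₁ v) (inj₂ (v , x)) ≡ true
  adj-hub-leaf v x = ⌊⌋≡true⁺ (v ≟ v) refl

  adj-leaf-leaf : ∀ v x y → adj G (inj₂ (v , x)) (inj₂ (v , y)) ≡ adj (X v) x y
  adj-leaf-leaf v x y with v ≟ v
  ... | yes refl = refl
  ... | no v≢v   = contradiction refl v≢v

  adj-leaf-leaf⇒≡ : ∀ {v w} x y → adj G (inj₂ (v , x)) (inj₂ (w , y)) ≡ true → v ≡ w
  adj-leaf-leaf⇒≡ {v} {w} x y with v ≟ w
  ... | yes v≡w = λ _ → v≡w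
  ... | no  _   = λ ()

  toCone : (v : V H) → V G → V (cone (X v))
  toCone v (inj₁ _)       = Cone.apex (X v)
  toCone v (inj₂ (w , x)) with w ≟ v
  ... | yes refl = Cone.leaf (X v) x
  ... | no  _    = Cone.apex (X v)

  toCone-leaf : ∀ v x → toCone v (inj₂ (v , x)) ≡ Cone.leaf (X v) x
  toCone-leaf v x with v ≟ v
  ... | yes refl = refl
  ... | no v≢v   = contradiction refl v≢v

  fromCone : (v : V H) → V (cone (X v)) → V G
  fromCone v (inj₁ _)       = inj₁ v
  fromCone v (inj₂ (_ , x)) = inj₂ (v , x)

  toCone-embedding : ∀ v → EmbeddingOn G (cone (X v)) (InBlock v) (toCone v)
  toCone-embedding v = record { adj-≡ = adj-≡ ; injective = injective }
    where
      adj-≡ : ∀ {a b} → InBlock v a → InBlock v b → adj (cone (X v)) (toCone v a) (toCone v b) ≡ adj G a b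
      adj-≡ hub      hub      = sym (adj-irrefl H v)
      adj-≡ hub      (leaf y) rewrite toCone-leaf v y = sym (adj-hub-leaf v y)
      adj-≡ (leaf x) hub      rewrite toCone-leaf v x = sym (adj-hub-leaf v x)
      adj-≡ (leaf x) (leaf y) rewrite toCone-leaf v x | toCone-leaf v y = sym (adj-leaf-leaf v x y)
      injective : ∀ {a b} → InBlock v a → InBlock v b → toCone v a ≡ toCone v b → a ≡ b
      injective hub      hub      _  = refl
      injective hub      (leaf y) eq with () ← trans eq (toCone-leaf v y)
      injective (leaf x) hub      eq with () ← trans (sym (toCone-leaf v x)) eq
      injective (leaf x) (leaf y) eq with refl ← trans (sym (toCone-leaf v x)) (trans eq (toCone-leaf v y)) = refl

  fromCone-embedding : ∀ v → EmbeddingOn (cone (X v)) G (λ _ → ⊤) (fromCone v)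
  fromCone-embedding v = record { adj-≡ = λ {a} {b} _ _ → adj-≡ a b ; injective = λ {a} {b} _ _ → injective a b }
    where
      adj-≡ : ∀ a b → adj G (fromCone v a) (fromCone v b) ≡ adj (cone (X v)) a b
      adj-≡ (inj₁ _)       (inj₁ _)       = adj-irrefl H v
      adj-≡ (inj₁ _)       (inj₂ (_ , y)) = adj-hub-leaf v y
      adj-≡ (inj₂ (_ , x)) (inj₁ _)       = adj-hub-leaf v x
      adj-≡ (inj₂ (_ , x)) (inj₂ (_ , y)) = adj-leaf-leaf v x y
      injective : ∀ a b → fromCone v a ≡ fromCone v b → a ≡ b
      injective (inj₁ tt)       (inj₁ tt)       _    = refl
      injective (inj₂ (tt , x)) (inj₂ (tt , y)) refl = refl

  private
    module BlockFibres = Fibres block _≟_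

  α-lower : sum (map (α ∘ X) (verts H)) ≤ α G
  α-lower = subst (_≤ α G) |T|≡Σα (independent⇒≤α G T-independent)
    where
      S : ∀ v → List (V (X v))
      S v = proj₁ (maximumIndependentSet (X v))
      module S v = IsIndependent (proj₁ (proj₂ (maximumIndependentSet (X v))))

      leavesOf : V H → List (V G)
      leavesOf v = map (λ x → inj₂ (v , x)) (S v)
      T = concatMap leavesOf (verts H)

      ∈-T⁻ : ∀ {a} → a ∈ T → ∃ λ v → ∃ λ x → a ≡ inj₂ (v , x) × x ∈ S v
      ∈-T⁻ a∈ with find (∈-concatMap⁻ leavesOf {xs = verts H} a∈)
      ... | v , _ , a∈leaves with ∈-map⁻ _ a∈leaves
      ...   | x , x∈ , refl = v , x , refl , x∈

      nonadjacent : ∀ {a b} → a ∈ T → b ∈ T → adj G a b ≡ false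
      nonadjacent a∈ b∈ with ∈-T⁻ a∈ | ∈-T⁻ b∈
      ... | v , x , refl , x∈ | w , y , refl , y∈ with v ≟ w
      ...   | yes refl = S.nonadjacent v x∈ y∈
      ...   | no  _    = refl

      T-independent : IsIndependent G T
      T-independent = record
        { unique      = Unique-concatMap block (verts-unique H)
                          (λ v → Unique.map⁺ (λ { refl → refl }) (S.unique v))
                          (λ v → AllP.map⁺ (All.tabulate (λ _ → refl)))
        ; nonadjacent = nonadjacent
        }

      |T|≡Σα : length T ≡ sum (map (α ∘ X) (verts H))
      |T|≡Σα = trans (length-concatMap leavesOf (verts H)) (cong sum (map-cong |leaves|≡α (verts H)))
        where
          |leaves|≡α : ∀ v → length (leavesOf v) ≡ α (X v)
          |leaves|≡α v = trans (length-map _ (S v)) (proj₂ (proj₂ (maximumIndependentSet (X v))))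

  I : Graph
  I = induced H (inF H X)

  hub-embedding : EmbeddingOn I G (λ _ → ⊤) (inj₁ ∘ proj₁)
  hub-embedding = record
    { adj-≡     = λ _ _ → refl
    ; injective = λ { {u , p} {.u , q} _ _ refl → cong (u ,_) (bool-irr p q) }
    }

  coneMatching : ∀ v → ∃ λ M → IsMatching (cone (X v)) M × length M ≡ μ (cone (X v))
                                × (inF H X v ≡ true → Cone.apex (X v) ∉ endpoints M)
  coneMatching v with μ (X v) ℕ.≟ μ (cone (X v))
  ... | yes μ≡ = let M , M-match , |M|≡μ , apex∉ = Cone.apex-free-maximumMatching (X v) μ≡
                 in M , M-match , |M|≡μ , λ _ → apex∉
  ... | no _   = let M , M-match , |M|≡μ = maximumMatching (cone (X v))
                 in M , M-match , |M|≡μ , λ ()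

  extend-by-cones : ∀ {MF} → IsMatching I MF → length MF + sum (map (λ v → μ (cone (X v))) (verts H)) ≤ μ G
  extend-by-cones {MF} MF-match = subst (_≤ μ G) |LF++Bs|≡ (matching⇒≤μ G (++-IsMatching LF-match Bs-match disjoint))
    where
      LF : List (V G × V G)
      LF = mapEdges (inj₁ ∘ proj₁) MF

      LF-match : IsMatching G LF
      LF-match = mapEdges-IsMatching hub-embedding MF-match (All.tabulate (λ _ → tt))

      B : V H → List (V G × V G)
      B v = mapEdges (fromCone v) (proj₁ (coneMatching v))

      B-block : ∀ v → All (λ a → block a ≡ v) (endpoints (B v))
      B-block v = subst (All _) (sym (endpoints-mapEdges (fromCone v) (proj₁ (coneMatching v))))
                        (AllP.map⁺ (All.tabulate λ { {inj₁ _} _ → refl ; {inj₂ _} _ → refl }))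

      Bs : List (V G × V G)
      Bs = concatMap B (verts H)

      Bs-match : IsMatching G Bs
      Bs-match = concatMap-IsMatching block (verts-unique H)
        (λ v → mapEdges-IsMatching (fromCone-embedding v) (proj₁ (proj₂ (coneMatching v))) (All.tabulate (λ _ → tt)))
        B-block

      -- a hub in F is matched in LF; the cone matching of its block avoids the apex
      disjoint : Disjoint (endpoints LF) (endpoints Bs)
      disjoint {a} (a∈LF , a∈Bs) with ∈-map⁻ _ (subst (a ∈_) (endpoints-mapEdges _ MF) a∈LF)
      ... | (u , u∈F) , _ , refl
        with find (∈-concatMap⁻ (endpoints ∘ B) {xs = verts H} (subst (a ∈_) (endpoints-concatMap B (verts H)) a∈Bs))
      ...   | v , _ , a∈Bv
        with ∈-map⁻ (fromCone v) (subst (a ∈_) (endpoints-mapEdges (fromCone v) (proj₁ (coneMatching v))) a∈Bv)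
      ...     | inj₁ tt , apex∈ , refl = proj₂ (proj₂ (proj₂ (coneMatching v))) u∈F apex∈

      |LF++Bs|≡ : length (LF ++ Bs) ≡ length MF + sum (map (λ v → μ (cone (X v))) (verts H))
      |LF++Bs|≡ = begin
        length (LF ++ Bs)
          ≡⟨ length-++ LF ⟩
        length LF + length Bs
          ≡⟨ cong₂ _+_ (length-map _ MF) (length-concatMap B (verts H)) ⟩
        length MF + sum (map (length ∘ B) (verts H))
          ≡⟨ cong (length MF +_) (cong sum (map-cong |B|≡μ (verts H))) ⟩
        length MF + sum (map (λ v → μ (cone (X v))) (verts H))
          ∎
        where
          open ≡-Reasoning
          |B|≡μ : ∀ v → length (B v) ≡ μ (cone (X v))
          |B|≡μ v = trans (length-map _ (proj₁ (coneMatching v))) (proj₁ (proj₂ (proj₂ (coneMatching v))))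

  μ-lower : μ I + sum (map (λ v → μ (cone (X v))) (verts H)) ≤ μ G
  μ-lower = let MF , MF-match , |MF|≡μ = maximumMatching I in
            subst (_≤ μ G) (cong (_+ sum (map (λ v → μ (cone (X v))) (verts H))) |MF|≡μ) (extend-by-cones MF-match)

  inFF : V G × V G → Bool
  inFF (inj₁ u , inj₁ w) = inF H X u ∧ inF H X w
  inFF (inj₁ _ , inj₂ _) = false
  inFF (inj₂ _ , _)      = false

  -- The block an edge outside H[F] is charged to: for an edge of H, an endpoint outside F.
  owner : V G × V G → V H
  owner (inj₁ u , inj₁ w)       = if inF H X u then w else u
  owner (inj₁ _ , inj₂ (w , _)) = w
  owner (inj₂ (w , _) , _)      = w

  owned-edge : ∀ {v} e → Adjacent G e → inFF e ≡ false → owner e ≡ v →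
    All (InBlock v) (ends e) ⊎ (inj₁ v ∈ ends e × inF H X v ≡ false)
  owned-edge (inj₁ u , inj₁ w) _ e∉FF refl = inj₂ (outside-F (inF H X u) refl e∉FF)
    where
      outside-F : ∀ b → inF H X u ≡ b → b ∧ inF H X w ≡ false →
        let v = if b then w else u in inj₁ v ∈ ends (inj₁ u , inj₁ w) × inF H X v ≡ false
      outside-F true  _   w∉F = there (here refl) , w∉F
      outside-F false u∉F _   = here refl , u∉F
  owned-edge (inj₁ u , inj₂ (w , x)) uw _ refl with refl ← ⌊⌋≡true⁻ (u ≟ w) uw = inj₁ (hub ∷ leaf x ∷ [])
  owned-edge (inj₂ (w , x) , inj₁ u) wu _ refl with refl ← ⌊⌋≡true⁻ (u ≟ w) wu = inj₁ (leaf x ∷ hub ∷ [])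
  owned-edge (inj₂ (w , x) , inj₂ (w′ , y)) ww′ _ refl with refl ← adj-leaf-leaf⇒≡ x y ww′ = inj₁ (leaf x ∷ leaf y ∷ [])

  IsFHub : V G → Set
  IsFHub a = ∃ λ u → a ≡ inj₁ u × inF H X u ≡ true

  hub-projection : EmbeddingOn G H IsFHub block
  hub-projection = record
    { adj-≡     = λ { (_ , refl , _) (_ , refl , _) → refl }
    ; injective = λ { (_ , refl , _) (_ , refl , _) → cong inj₁ }
    }

  inFF-ends : ∀ e → inFF e ≡ true → All IsFHub (ends e)
  inFF-ends (inj₁ u , inj₁ w) e∈FF = let u∈F , w∈F = ∧≡true⁻ e∈FF in (u , refl , u∈F) ∷ (w , refl , w∈F) ∷ []

  inFF-matching⇒≤μ : ∀ {M} → IsMatching G M → All (λ e → inFF e ≡ true) M → length M ≤ μ I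
  inFF-matching⇒≤μ {M} M-match M∈FF = subst (_≤ μ I) (length-map _ M)
    (matching⇒≤μ-induced H (inF H X) (mapEdges-IsMatching hub-projection M-match hubs) F-ends)
    where
      hubs : All IsFHub (endpoints M)
      hubs = All.tabulate λ a∈ → let e , e∈ , a∈e = ∈-endpoints⁻ M a∈ in All.lookup (inFF-ends e (All.lookup M∈FF e∈)) a∈e
      F-ends : All (λ u → inF H X u ≡ true) (endpoints (mapEdges block M))
      F-ends = subst (All _) (sym (endpoints-mapEdges block M)) (AllP.map⁺ (All.map (λ { (_ , refl , u∈F) → u∈F }) hubs))

  module _ (x₀ : ∀ v → V (X v)) where

    leaf-embedding : ∀ v → EmbeddingOn G (X v) (λ a → InBlock v a × a ≢ inj₁ v) (Cone.unleaf (X v) (x₀ v) ∘ toCone v)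
    leaf-embedding v = EmbeddingOn-∘ (λ (a∈v , a≢hub) → a∈v , toCone-≢apex a∈v a≢hub)
                                     (toCone-embedding v) (Cone.unleaf-embedding (X v) (x₀ v))
      where
        toCone-≢apex : ∀ {a} → InBlock v a → a ≢ inj₁ v → toCone v a ≢ Cone.apex (X v)
        toCone-≢apex hub      hub≢hub = contradiction refl hub≢hub
        toCone-≢apex (leaf x) _       rewrite toCone-leaf v x = λ ()

    block-independent⇒≤α : ∀ v {T} → IsIndependent G T → All (λ a → block a ≡ v) T → length T ≤ α (X v)
    block-independent⇒≤α v {T} T-ind T⊆v with DecMembership._∈?_ (_≟V_ G) (inj₁ v) T
    ... | yes hub∈ = ≤-trans (Unique∧All≡⇒length≤1 unique (All.tabulate only-hub)) (1≤α (X v) (x₀ v))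
      where
        open IsIndependent T-ind
        -- every leaf of the block is adjacent to its hub
        only-hub : ∀ {a} → a ∈ T → a ≡ inj₁ v
        only-hub {a} a∈ with inBlock a (All.lookup T⊆v a∈)
        ... | hub    = refl
        ... | leaf x = case trans (sym (nonadjacent hub∈ a∈)) (adj-hub-leaf v x) of λ ()
    ... | no hub∉ = independent⇒≤α-via (leaf-embedding v) T-ind
                      (All.tabulate λ a∈ → inBlock _ (All.lookup T⊆v a∈) , λ { refl → hub∉ a∈ })

    α-upper : α G ≤ sum (map (α ∘ X) (verts H))
    α-upper = α-≤ G λ {S} S-ind → begin
      length S
        ≡⟨ BlockFibres.length≡sum-length-fibre (verts-unique H) (verts-complete H ∘ block) S ⟩
      sum (map (λ v → length (BlockFibres.fibre v S)) (verts H))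
        ≤⟨ sum-map-mono-≤ (λ v → block-independent⇒≤α v (filterᵇ-IsIndependent _ S-ind) (BlockFibres.All-fibre v S))
                          (verts H) ⟩
      sum (map (α ∘ X) (verts H))
        ∎
      where open ≤-Reasoning

    μ≢μ-cone : ∀ {v} → inF H X v ≡ false → μ (X v) ≢ μ (cone (X v))
    μ≢μ-cone {v} v∉F μ≡ = case trans (sym (⌊⌋≡true⁺ (μ (X v) ℕ.≟ μ (cone (X v))) μ≡)) v∉F of λ ()

    Σμ-cone≡Σμ+|V∖F| : sum (map (λ v → μ (cone (X v))) (verts H))
                     ≡ sum (map (λ v → μ (X v)) (verts H)) + length (filterᵇ (λ v → not (inF H X v)) (verts H))
    Σμ-cone≡Σμ+|V∖F| = sum-map≡sum-map+count _ _ _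
      (λ v v∉F → Cone.μ-cone≡suc (X v) (x₀ v) (μ≢μ-cone (not-injective v∉F)))
      (λ v v∈F → sym (⌊⌋≡true⁻ (μ (X v) ℕ.≟ μ (cone (X v))) (not-injective v∈F)))
      (verts H)

    owned-matching⇒≤μ-cone : ∀ v {B} → IsMatching G B → All (λ e → inFF e ≡ false) B → All (λ e → owner e ≡ v) B →
      length B ≤ μ (cone (X v))
    owned-matching⇒≤μ-cone v {B} B-match B∉FF B-owned = bound (inF H X v) refl
      where
        owned : ∀ {e} → e ∈ B → All (InBlock v) (ends e) ⊎ (inj₁ v ∈ ends e × inF H X v ≡ false)
        owned e∈ = owned-edge _ (All.lookup (IsMatching.adjacent B-match) e∈) (All.lookup B∉FF e∈) (All.lookup B-owned e∈)

        N = avoiding (_≟V_ G) (inj₁ v) B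

        leaf-end : ∀ {a} → a ∈ endpoints N → InBlock v a × a ≢ inj₁ v
        leaf-end a∈ with ∈-endpoints⁻ N a∈
        ... | e , e∈N , a∈e with ∈-avoiding⁻ (_≟V_ G) (inj₁ v) B e∈N
        ...   | e∈B , hub∉e with owned e∈B
        ...     | inj₁ e⊆v         = All.lookup e⊆v a∈e , λ { refl → hub∉e a∈e }
        ...     | inj₂ (hub∈e , _) = contradiction hub∈e hub∉e

        bound : ∀ b → inF H X v ≡ b → length B ≤ μ (cone (X v))
        bound true v∈F = matching⇒≤μ-via (toCone-embedding v) B-match (All.tabulate in-block)
          where
            in-block : ∀ {a} → a ∈ endpoints B → InBlock v a
            in-block a∈ with ∈-endpoints⁻ B a∈
            ... | e , e∈ , a∈e with owned e∈
            ...   | inj₁ e⊆v        = All.lookup e⊆v a∈e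
            ...   | inj₂ (_ , v∉F) = case trans (sym v∈F) v∉F of λ ()
        bound false v∉F = begin
          length B
            ≤⟨ length≤suc-avoiding (_≟V_ G) (inj₁ v) B (IsMatching.endpoints-unique B-match) ⟩
          suc (length N)
            ≤⟨ s≤s (matching⇒≤μ-via (leaf-embedding v) (filterᵇ-IsMatching _ B-match) (All.tabulate leaf-end)) ⟩
          suc (μ (X v))
            ≡⟨ Cone.μ-cone≡suc (X v) (x₀ v) (μ≢μ-cone v∉F) ⟨
          μ (cone (X v))
            ∎
          where open ≤-Reasoning

    μ-upper : μ G ≤ μ I + sum (map (λ v → μ (cone (X v))) (verts H))
    μ-upper = μ-≤ G λ {M} M-match → begin
      length M
        ≡⟨ length-filterᵇ-split inFF M ⟩
      length (filterᵇ inFF M) + length (rest M)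
        ≤⟨ +-mono-≤ (inFF-matching⇒≤μ (filterᵇ-IsMatching inFF M-match) (FF M)) (rest-bound M-match) ⟩
      μ I + sum (map (λ v → μ (cone (X v))) (verts H))
        ∎
      where
        open ≤-Reasoning
        module OwnerFibres = Fibres owner _≟_

        rest : List (V G × V G) → List (V G × V G)
        rest = filterᵇ (not ∘ inFF)

        FF : ∀ M → All (λ e → inFF e ≡ true) (filterᵇ inFF M)
        FF M = All.tabulate (λ e∈ → proj₂ (∈-filterᵇ⁻ inFF {xs = M} e∈))

        rest∉FF : ∀ M → All (λ e → inFF e ≡ false) (rest M)
        rest∉FF M = All.tabulate (λ e∈ → not-injective (proj₂ (∈-filterᵇ⁻ (not ∘ inFF) {xs = M} e∈)))

        rest-bound : ∀ {M} → IsMatching G M → length (rest M) ≤ sum (map (λ v → μ (cone (X v))) (verts H))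
        rest-bound {M} M-match = begin
          length (rest M)
            ≡⟨ OwnerFibres.length≡sum-length-fibre (verts-unique H) (verts-complete H ∘ owner) (rest M) ⟩
          sum (map (λ v → length (OwnerFibres.fibre v (rest M))) (verts H))
            ≤⟨ sum-map-mono-≤ block-bound (verts H) ⟩
          sum (map (λ v → μ (cone (X v))) (verts H)) ∎
          where
            block-bound : ∀ v → length (OwnerFibres.fibre v (rest M)) ≤ μ (cone (X v))
            block-bound v = owned-matching⇒≤μ-cone v (filterᵇ-IsMatching _ (filterᵇ-IsMatching _ M-match))
                              (anti-mono (filter-⊆ _ (rest M)) (rest∉FF M)) (OwnerFibres.All-fibre v (rest M))

    α-corona : α G ≡ sum (map (λ v → α (X v)) (verts H))
    α-corona = ≤-antisym α-upper α-lower

    μ-corona : μ G ≡ μ I + sum (map (λ v → μ (cone (X v))) (verts H))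
    μ-corona = ≤-antisym μ-upper μ-lower

theorem2p1 : (H : Graph) (X : V H → Graph) →
    (∀ v → V (X v)) →
    (α (corona H X) ≡ sum (map (λ v → α (X v)) (verts H)))
    × (μ (corona H X) ≡ μ (induced H (inF H X)) + sum (map (λ v → μ (cone (X v))) (verts H)))
    × (sum (map (λ v → μ (cone (X v))) (verts H))
         ≡ sum (map (λ v → μ (X v)) (verts H)) + length (filterᵇ (λ v → not (inF H X v)) (verts H)))
theorem2p1 H X x₀ = α-corona x₀ , μ-corona x₀ , Σμ-cone≡Σμ+|V∖F| x₀
  where open Corona H X
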